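{- Let $\sigma$ and $a\lambda$ be sequences of distinct numbers, both of length greater than $1$, such that $a\lambda$ begins with its largest term $a$ and $a\lambda$ is a subsequence of $B(\sigma)$. Then there exists a term $b>a$ of $\sigma$ such that $\sigma$ contains one of $ab\lambda$ and $ba\lambda$ as a subsequence.
   Context: For any finite sequence of distinct numbers, the operator $B$ (one pass of bubble sort) is defined recursively by $B(\epsilon)=\epsilon$ for the empty sequence and, writing a non-empty sequence as $\sigma=\sigma_1 m\sigma_2$ with $m$ its largest term, $B(\sigma)=B(\sigma_1)\sigma_2 m$. Subsequences need not be consecutive. -}

module Defs where

open import Data.Nat using (ℕ; zero; suc; _⊔_)
open import Data.Nat.Properties using (_≟_)
open import Data.List using (List; []; _∷_; _++_; [_]; length; foldr)
open import Data.Product using (_×_; _,_)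
open import Relation.Nullary using (yes; no)

-- Sequences of distinct numbers are modelled as lists of natural numbers
-- (with a separate distinctness hypothesis); only the relative order of the
-- terms matters.

-- Largest term of a list (0 for the empty list; only used on non-empty lists).
maxList : List ℕ → ℕ
maxList = foldr _⊔_ 0

splitAtVal : ℕ → List ℕ → List ℕ × List ℕ
splitAtVal m [] = [] , []
splitAtVal m (x ∷ xs) with x ≟ m
... | yes _ = [] , xs
... | no _ with splitAtVal m xs
...   | (l , r) = (x ∷ l) , r

-- One pass of bubble sort, by the recursion B(ε)=ε, B(σ₁ m σ₂) = B(σ₁) σ₂ m,
-- with a fuel argument (σ₁ is strictly shorter than σ, so length σ suffices).
Bfuel : ℕ → List ℕ → List ℕ
Bfuel zero    _  = []
Bfuel (suc n) [] = []
Bfuel (suc n) σ@(_ ∷ _) with splitAtVal (maxList σ) σ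
... | (σ₁ , σ₂) = Bfuel n σ₁ ++ σ₂ ++ [ maxList σ ]

B : List ℕ → List ℕ
B σ = Bfuel (length σ) σ

-- Induction on the recursion B(σ₁ m σ₂) = B(σ₁) σ₂ m. Split an occurrence of
-- aλ in B(σ₁) σ₂ m at the boundary after B(σ₁). If a already lies in σ₂ m, then
-- a ≠ m (a is followed by λ, m is last) and a < m; all of aλ lies in σ₂, so
-- b = m works with ba λ. Otherwise a ∈ σ₁, so again a < m, and the part of λ
-- in B(σ₁) is either empty (take b = m, giving a m λ in σ₁ m σ₂) or handled by
-- the induction hypothesis for σ₁, with the rest of λ appended from σ₂.
module Submission where

open import Defs
open import Data.Nat using (ℕ; zero; suc; _<_; _≤_)
open import Data.Nat.Properties
  using (m≤m⊔n; m≤n⊔m; ⊔-identityʳ; ⊔-sel; ≤-trans; <-trans; ≤∧≢⇒<; >⇒≢; <-irrefl; _≟_)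
open import Data.List using (List; []; _∷_; _++_; [_]; length)
open import Data.List.Relation.Unary.All as All using (All; []; _∷_)
open import Data.List.Relation.Unary.All.Properties using (All¬⇒¬Any; ++⁺; ++⁻ˡ; ++⁻ʳ)
open import Data.List.Relation.Unary.Any using (here; there)
open import Data.List.Relation.Unary.AllPairs using (_∷_)
open import Data.List.Relation.Unary.Unique.Propositional using (Unique; [])
open import Data.List.Relation.Unary.Unique.Propositional.Properties
  using (Unique[x∷xs]⇒x∉xs)
open import Data.List.Relation.Binary.Sublist.Propositional
  using (_⊆_; []; _∷_; _∷ʳ_; lookup; from∈)
import Data.List.Relation.Binary.Sublist.Propositional.Properties as Sublist
open import Data.List.Membership.Propositional using (_∈_; _∉_)
open import Data.List.Membership.Propositional.Properties using (∈-++⁺ˡ; ∈-++⁺ʳ)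
open import Data.Product using (Σ; ∃₂; _×_; _,_; proj₁; proj₂)
open import Data.Sum using (_⊎_; inj₁; inj₂)
import Data.Sum as Sum
open import Data.Empty using (⊥-elim)
open import Relation.Nullary using (yes; no)
open import Relation.Binary.PropositionalEquality using (_≡_; _≢_; ≢-sym; refl; sym; cong; subst; subst₂)

private
  variable
    a m z : ℕ
    xs ys zs σ σ₁ σ₂ τ λ₁ λ₂ : List ℕ

⊆-++-split : ∀ ys → xs ⊆ ys ++ zs → ∃₂ λ xs₁ xs₂ → xs ≡ xs₁ ++ xs₂ × xs₁ ⊆ ys × xs₂ ⊆ zs
⊆-++-split [] p = [] , _ , refl , [] , p
⊆-++-split (y ∷ ys) (.y ∷ʳ p) with ⊆-++-split ys p
... | xs₁ , xs₂ , refl , q , r = xs₁ , xs₂ , refl , y ∷ʳ q , r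
⊆-++-split (y ∷ ys) (refl ∷ p) with ⊆-++-split ys p
... | xs₁ , xs₂ , refl , q , r = y ∷ xs₁ , xs₂ , refl , refl ∷ q , r

drop-last-⊆ : ∀ ys → z ∉ xs → xs ⊆ ys ++ [ z ] → xs ⊆ ys
drop-last-⊆ [] z∉xs (_ ∷ʳ p) = p
drop-last-⊆ [] z∉xs (refl ∷ _) = ⊥-elim (z∉xs (here refl))
drop-last-⊆ (y ∷ ys) z∉xs (.y ∷ʳ p) = y ∷ʳ drop-last-⊆ ys z∉xs p
drop-last-⊆ (y ∷ ys) z∉xs (refl ∷ p) = refl ∷ drop-last-⊆ ys (λ z∈ → z∉xs (there z∈)) p

head-∈-init : ∀ {x} ys → xs ≢ [] → x ∷ xs ⊆ ys ++ [ z ] → x ∈ ys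
head-∈-init [] xs≢[] (_ ∷ʳ ())
head-∈-init [] xs≢[] (refl ∷ []) = ⊥-elim (xs≢[] refl)
head-∈-init (y ∷ ys) xs≢[] (.y ∷ʳ p) = there (head-∈-init ys xs≢[] p)
head-∈-init (y ∷ ys) xs≢[] (refl ∷ _) = here refl

All<⇒∉ : All (_< z) xs → z ∉ xs
All<⇒∉ xs<z = All¬⇒¬Any (All.map >⇒≢ xs<z)

All-<-trans : a < m → All (_< a) xs → All (_< m) xs
All-<-trans a<m = All.map (λ x<a → <-trans x<a a<m)

Unique-++⁻ˡ : ∀ xs → Unique (xs ++ ys) → Unique xs
Unique-++⁻ˡ [] _ = []
Unique-++⁻ˡ (x ∷ xs) (x≢ ∷ u) = ++⁻ˡ xs x≢ ∷ Unique-++⁻ˡ xs u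

Unique[xs++z∷ys]⇒z∉xs : ∀ xs → Unique (xs ++ z ∷ ys) → z ∉ xs
Unique[xs++z∷ys]⇒z∉xs (x ∷ xs) (x≢ ∷ _) (here refl) = All.lookup x≢ (∈-++⁺ʳ xs (here refl)) refl
Unique[xs++z∷ys]⇒z∉xs (x ∷ xs) (_ ∷ u) (there z∈xs) = Unique[xs++z∷ys]⇒z∉xs xs u z∈xs

Unique[xs++z∷ys]⇒z∉ys : ∀ xs → Unique (xs ++ z ∷ ys) → z ∉ ys
Unique[xs++z∷ys]⇒z∉ys [] u = Unique[x∷xs]⇒x∉xs u
Unique[xs++z∷ys]⇒z∉ys (x ∷ xs) (_ ∷ u) = Unique[xs++z∷ys]⇒z∉ys xs u

maxList-upperBound : ∀ xs → All (_≤ maxList xs) xs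
maxList-upperBound [] = []
maxList-upperBound (x ∷ xs) =
  m≤m⊔n x (maxList xs) ∷
  All.map (λ y≤ → ≤-trans y≤ (m≤n⊔m x (maxList xs))) (maxList-upperBound xs)

maxList-∈ : ∀ x xs → maxList (x ∷ xs) ∈ x ∷ xs
maxList-∈ x [] rewrite ⊔-identityʳ x = here refl
maxList-∈ x (y ∷ ys) with ⊔-sel x (maxList (y ∷ ys))
... | inj₁ max≡x rewrite max≡x = here refl
... | inj₂ max≡rest rewrite max≡rest = there (maxList-∈ y ys)

splitAtVal-++ : ∀ {l r} → splitAtVal m xs ≡ (l , r) → m ∈ xs → xs ≡ l ++ m ∷ r
splitAtVal-++ {m} {x ∷ xs} eq m∈ with x ≟ m
splitAtVal-++ {m} {x ∷ xs} refl _ | yes refl = refl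
splitAtVal-++ {m} {x ∷ xs} eq (here refl) | no x≢m = ⊥-elim (x≢m refl)
splitAtVal-++ {m} {x ∷ xs} eq (there m∈xs) | no _ with splitAtVal m xs in eq′
splitAtVal-++ {m} {x ∷ xs} refl (there m∈xs) | no _ | _ = cong (x ∷_) (splitAtVal-++ eq′ m∈xs)

record MaxSplit (n : ℕ) (σ : List ℕ) : Set where
  field
    left right : List ℕ
    σ-split : σ ≡ left ++ maxList σ ∷ right
    Bfuel-split : Bfuel (suc n) σ ≡ Bfuel n left ++ right ++ [ maxList σ ]

maxSplit : ∀ n x xs → MaxSplit n (x ∷ xs)
maxSplit n x xs = record
  { left        = proj₁ s
  ; right       = proj₂ s
  ; σ-split     = splitAtVal-++ refl (maxList-∈ x xs)
  ; Bfuel-split = refl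
  }
  where s = splitAtVal (maxList (x ∷ xs)) (x ∷ xs)

All-Bfuel : ∀ {P : ℕ → Set} n → All P σ → All P (Bfuel n σ)
All-Bfuel zero _ = []
All-Bfuel {[]} (suc n) _ = []
All-Bfuel {x ∷ xs} {P} (suc n) pσ =
  subst (All P) (sym Bfuel-split) (++⁺ (All-Bfuel n (++⁻ˡ left ps)) (++⁺ pr (pm ∷ [])))
  where
  open MaxSplit (maxSplit n x xs)
  ps = subst (All P) σ-split pσ
  pm∷pr = ++⁻ʳ left ps
  pm = All.head pm∷pr
  pr = All.tail pm∷pr

∈-Bfuel⁻ : ∀ n {x} → x ∈ Bfuel n σ → x ∈ σ
∈-Bfuel⁻ n = All.lookup (All-Bfuel n (All.tabulate (λ x∈ → x∈)))

Overtaken : List ℕ → ℕ → List ℕ → Set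
Overtaken σ a λ' = Σ ℕ λ b → b ∈ σ × a < b × ((a ∷ b ∷ λ') ⊆ σ ⊎ (b ∷ a ∷ λ') ⊆ σ)

Overtaken-++ : Overtaken σ₁ a λ₁ → λ₂ ⊆ σ₂ → Overtaken (σ₁ ++ σ₂) a (λ₁ ++ λ₂)
Overtaken-++ (b , b∈ , a<b , p) r =
  b , ∈-++⁺ˡ b∈ , a<b , Sum.map (λ q → Sublist.++⁺ q r) (λ q → Sublist.++⁺ q r) p

Traceable : List ℕ → List ℕ → Set
Traceable τ σ = ∀ {a λ'} → λ' ≢ [] → All (_< a) λ' → a ∷ λ' ⊆ τ → Overtaken σ a λ'

<-unique-max : Unique (σ₁ ++ m ∷ σ₂) → All (_≤ m) (σ₁ ++ m ∷ σ₂) → a ∈ σ₁ ⊎ a ∈ σ₂ → a < m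
<-unique-max {σ₁} u ≤m (inj₁ a∈σ₁) =
  ≤∧≢⇒< (All.lookup ≤m (∈-++⁺ˡ a∈σ₁)) λ { refl → Unique[xs++z∷ys]⇒z∉xs σ₁ u a∈σ₁ }
<-unique-max {σ₁} u ≤m (inj₂ a∈σ₂) =
  ≤∧≢⇒< (All.lookup ≤m (∈-++⁺ʳ σ₁ (there a∈σ₂))) λ { refl → Unique[xs++z∷ys]⇒z∉ys σ₁ u a∈σ₂ }

traceable-step : Unique (σ₁ ++ m ∷ σ₂) → All (_≤ m) (σ₁ ++ m ∷ σ₂) →
                 (∀ {x} → x ∈ τ → x ∈ σ₁) → Traceable τ σ₁ →
                 Traceable (τ ++ σ₂ ++ [ m ]) (σ₁ ++ m ∷ σ₂)
traceable-step {σ₁} {m} {σ₂} {τ} u ≤m τ⊆σ₁ trace {a} λ'≢[] λ'<a p with ⊆-++-split τ p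
... | [] , _ , refl , _ , r = m , ∈-++⁺ʳ σ₁ (here refl) , a<m , inj₂ (Sublist.++⁺ˡ σ₁ (refl ∷ aλ'⊆σ₂))
  where
  a<m = <-unique-max u ≤m (inj₂ (head-∈-init σ₂ λ'≢[] r))
  aλ'⊆σ₂ = drop-last-⊆ σ₂ (All<⇒∉ (a<m ∷ All-<-trans a<m λ'<a)) r
... | _ ∷ λ₁ , λ₂ , refl , q , r = from-left λ₁ q (++⁻ˡ λ₁ λ'<a)
  where
  a∈σ₁ = τ⊆σ₁ (lookup q (here refl))
  a<m = <-unique-max u ≤m (inj₁ a∈σ₁)
  λ₂⊆σ₂ : λ₂ ⊆ σ₂
  λ₂⊆σ₂ = drop-last-⊆ σ₂ (All<⇒∉ (All-<-trans a<m (++⁻ʳ λ₁ λ'<a))) r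
  from-left : ∀ λ₁ → a ∷ λ₁ ⊆ τ → All (_< a) λ₁ → Overtaken (σ₁ ++ m ∷ σ₂) a (λ₁ ++ λ₂)
  from-left [] _ _ = m , ∈-++⁺ʳ σ₁ (here refl) , a<m , inj₁ (Sublist.++⁺ (from∈ a∈σ₁) (refl ∷ λ₂⊆σ₂))
  from-left (_ ∷ _) q λ₁<a = Overtaken-++ (trace (λ ()) λ₁<a q) (m ∷ʳ λ₂⊆σ₂)

Bfuel-traceable : ∀ n → Unique σ → Traceable (Bfuel n σ) σ
Bfuel-traceable zero _ _ _ ()
Bfuel-traceable {[]} (suc n) _ _ _ ()
Bfuel-traceable {x ∷ xs} (suc n) u =
  subst₂ Traceable (sym Bfuel-split) (sym σ-split)
    (traceable-step u′ (subst (All (_≤ maxList (x ∷ xs))) σ-split (maxList-upperBound (x ∷ xs)))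
                    (∈-Bfuel⁻ n) (Bfuel-traceable n (Unique-++⁻ˡ left u′)))
  where
  open MaxSplit (maxSplit n x xs)
  u′ = subst Unique σ-split u

lemma2p4 : (σ λ' : List ℕ) (a : ℕ) →
           Unique σ → Unique (a ∷ λ') →
           1 < length σ → 1 < length (a ∷ λ') →
           All (λ x → x ≤ a) λ' →
           (a ∷ λ') ⊆ B σ →
           Σ ℕ (λ b → b ∈ σ × a < b × ((a ∷ b ∷ λ') ⊆ σ ⊎ (b ∷ a ∷ λ') ⊆ σ))
lemma2p4 σ λ' a uσ (a≢λ' ∷ _) _ 1<|aλ'| λ'≤a p = Bfuel-traceable (length σ) uσ λ'≢[] λ'<a p
  where
  λ'≢[] : λ' ≢ []
  λ'≢[] refl = <-irrefl refl 1<|aλ'|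
  λ'<a : All (_< a) λ'
  λ'<a = All.zipWith (λ (x≤a , a≢x) → ≤∧≢⇒< x≤a (≢-sym a≢x)) (λ'≤a , a≢λ')
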